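{- $E_1^{ce}\leq\left(=^{ce}\right)^+$.
   Context: $\phi_e$ is the $e$-th partial computable function, $W_e$ its domain; $=^{ce}$ is $e=^{ce}e'$ iff $W_e=W_{e'}$. With $\langle\cdot,\cdot\rangle$ the standard pairing and $A_{(n)}=\{p:\langle n,p\rangle\in A\}$, $E_1$ is the equivalence relation on $\mathcal P(\mathbb N)$ with $A\mathrel{E_1}B$ iff $A_{(n)}=B_{(n)}$ for all but finitely many $n$, and $E_1^{ce}$ is the equivalence relation on $\mathbb N$ with $e\mathrel{E_1^{ce}}e'$ iff $W_e\mathrel{E_1}W_{e'}$. The computable FS-jump is $E^+$ with $e\mathrel{E^+}e'$ iff $\{[\phi_e(n)]_E:\phi_e(n)\downarrow\}=\{[\phi_{e'}(n)]_E:\phi_{e'}(n)\downarrow\}$. $E\leq F$ means there is a total computable $f$ with $x\mathrel{E}y\iff f(x)\mathrel{F}f(y)$. -}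

module Defs where

open import Data.Nat using (ℕ; zero; suc; _+_; _*_; _≤_; _<_)
open import Data.Nat.DivMod using (_/_; _%_)
open import Data.Product using (_×_; _,_; proj₁; proj₂; Σ; ∃)
open import Relation.Binary.PropositionalEquality using (_≡_)

tri : ℕ → ℕ
tri zero    = zero
tri (suc n) = suc n + tri n

pair : ℕ → ℕ → ℕ
pair a b = tri (a + b) + b

-- inverse of pair, by walking the Cantor enumeration
-- (0,0),(1,0),(0,1),(2,0),(1,1),(0,2),...
unpair : ℕ → ℕ × ℕ
unpair zero = 0 , 0
unpair (suc n) with unpair n
... | zero  , b = suc b , 0
... | suc a , b = a , suc b

fst snd : ℕ → ℕ
fst z = proj₁ (unpair z)
snd z = proj₂ (unpair z)

-- A concrete model of computation: unary partial recursive functions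
-- on ℕ (several arguments are coded with the pairing function).

data Code : Set where
  Z S I L R : Code            -- 0, successor, identity, fst, snd
  comp      : Code → Code → Code   -- comp f g x = f (g x)
  pr        : Code → Code → Code   -- pairing  x ↦ ⟨f x , g x⟩
  prec      : Code → Code → Code
  mu        : Code → Code

mutual
  data Eval : Code → ℕ → ℕ → Set where
    evZ    : ∀ {x} → Eval Z x 0
    evS    : ∀ {x} → Eval S x (suc x)
    evI    : ∀ {x} → Eval I x x
    evL    : ∀ {x} → Eval L x (fst x)
    evR    : ∀ {x} → Eval R x (snd x)
    evComp : ∀ {f g x y v} → Eval g x y → Eval f y v → Eval (comp f g) x v
    evPr   : ∀ {f g x a b} → Eval f x a → Eval g x b → Eval (pr f g) x (pair a b)
    evPrec : ∀ {f g z v} → PrecEval f g (fst z) (snd z) v → Eval (prec f g) z v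
    evMu   : ∀ {f x n} → Eval f (pair x n) 0
           → (∀ m → m < n → Σ ℕ λ k → Eval f (pair x m) (suc k))
           → Eval (mu f) x n

  data PrecEval (f g : Code) (x : ℕ) : ℕ → ℕ → Set where
    prZero : ∀ {v} → Eval f x v → PrecEval f g x 0 v
    prSuc  : ∀ {n w v} → PrecEval f g x n w → Eval g (pair x (pair n w)) v
           → PrecEval f g x (suc n) v

-- Gödel numbering of codes: e = 9 * ⟨a,b⟩ + tag.
-- Sub-indices are smaller than e, so fuel e suffices.

decodeF : ℕ → ℕ → Code
decodeF zero     e = Z
decodeF (suc k) e with e % 9
... | 0 = Z
... | 1 = S
... | 2 = I
... | 3 = L
... | 4 = R
... | 5 = comp (decodeF k (fst (e / 9))) (decodeF k (snd (e / 9)))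
... | 6 = pr   (decodeF k (fst (e / 9))) (decodeF k (snd (e / 9)))
... | 7 = prec (decodeF k (fst (e / 9))) (decodeF k (snd (e / 9)))
... | _ = mu   (decodeF k (fst (e / 9)))

decode : ℕ → Code
decode e = decodeF (suc e) e

φ : ℕ → ℕ → ℕ → Set
φ e x v = Eval (decode e) x v

_↓_ : ℕ → ℕ → Set
e ↓ x = ∃ λ v → φ e x v

_∈W_ : ℕ → ℕ → Set
x ∈W e = e ↓ x

_⇔_ : Set → Set → Set
A ⇔ B = (A → B) × (B → A)

_=ce_ : ℕ → ℕ → Set
e =ce e' = ∀ x → (x ∈W e) ⇔ (x ∈W e')

-- E₁ on P(ℕ), applied to W_e, W_e' : columns agree for all but finitely many n
E₁ce : ℕ → ℕ → Set
E₁ce e e' = ∃ λ N → ∀ n → N ≤ n → ∀ p → (pair n p ∈W e) ⇔ (pair n p ∈W e')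

_⁺ : (ℕ → ℕ → Set) → ℕ → ℕ → Set
(E ⁺) e e' =
    (∀ n v → φ e n v → ∃ λ m → ∃ λ w → φ e' m w × E v w)
  × (∀ m w → φ e' m w → ∃ λ n → ∃ λ v → φ e n v × E v w)

TotalComputable : (ℕ → ℕ) → Set
TotalComputable f = ∃ λ c → ∀ x → φ c x (f x)

_≤c_ : (ℕ → ℕ → Set) → (ℕ → ℕ → Set) → Set
E ≤c F = ∃ λ (f : ℕ → ℕ) → TotalComputable f × (∀ x y → E x y ⇔ F (f x) (f y))

-- For k = ⟨n , d⟩, φ_{f e}(k) is an index of the set agreeing with W_d below column n
-- and with W_e from column n on, so up to =ᶜᵉ the range of φ_{f e} is the family of all
-- finite column patches of W_e. If W_e and W_e′ agree from column N, a patch P of W_e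
-- below n agrees with W_e′ from max(n, N) on, so patching W_e′ with P below max(n, N)
-- gives back P. Conversely W_e is its own patch below column 0, hence equals some patch
-- of W_e′, and every patch of W_e′ agrees with W_e′ from some column on.
module Submission where

open import Data.Empty using (⊥-elim)
open import Data.Nat
open import Data.Nat.DivMod
open import Data.Nat.Divisibility using (n∣m*n)
open import Data.Nat.Properties
open import Data.Product using (_×_; _,_; proj₁; proj₂; ∃)
open import Relation.Binary.Definitions using (tri<; tri≈; tri>)
open import Relation.Binary.PropositionalEquality
open import Relation.Nullary using (yes; no)
open import Relation.Nullary.Decidable using (True; toWitness)

open import Defs

-- Cantor pairing

pair-suc : ∀ a b → pair a (suc b) ≡ suc (pair (suc a) b)
pair-suc a b rewrite +-suc a b = +-suc (tri (suc (a + b))) b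

pair-suc-zero : ∀ a → pair (suc a) 0 ≡ suc (pair 0 a)
pair-suc-zero a rewrite +-identityʳ a | +-identityʳ (a + tri a) = cong suc (+-comm a (tri a))

unpair-pair′ : ∀ n a b → pair a b ≡ n → unpair n ≡ (a , b)
unpair-pair′ zero    zero    zero    _  = refl
unpair-pair′ zero    (suc a) zero    eq = ⊥-elim (0≢1+n (trans (sym eq) (pair-suc-zero a)))
unpair-pair′ zero    a       (suc b) eq = ⊥-elim (0≢1+n (trans (sym eq) (pair-suc a b)))
unpair-pair′ (suc n) zero    zero    ()
unpair-pair′ (suc n) (suc a) zero    eq
  rewrite unpair-pair′ n 0 a (suc-injective (trans (sym (pair-suc-zero a)) eq)) = refl
unpair-pair′ (suc n) a       (suc b) eq
  rewrite unpair-pair′ n (suc a) b (suc-injective (trans (sym (pair-suc a b)) eq)) = refl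

fst-pair : ∀ a b → fst (pair a b) ≡ a
fst-pair a b = cong proj₁ (unpair-pair′ _ a b refl)

snd-pair : ∀ a b → snd (pair a b) ≡ b
snd-pair a b = cong proj₂ (unpair-pair′ _ a b refl)

pair-fst-snd : ∀ n → pair (fst n) (snd n) ≡ n
pair-fst-snd zero = refl
pair-fst-snd (suc n) with unpair n | pair-fst-snd n
... | zero  , b | eq = trans (pair-suc-zero b) (cong suc eq)
... | suc a , b | eq = trans (pair-suc a b) (cong suc eq)

n≤tri[n] : ∀ n → n ≤ tri n
n≤tri[n] zero    = z≤n
n≤tri[n] (suc n) = m≤m+n (suc n) (tri n)

m≤pair[m,n] : ∀ m n → m ≤ pair m n
m≤pair[m,n] m n = ≤-trans (m≤m+n m n) (≤-trans (n≤tri[n] (m + n)) (m≤m+n (tri (m + n)) n))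

n≤pair[m,n] : ∀ m n → n ≤ pair m n
n≤pair[m,n] m n = m≤n+m n (tri (m + n))

fst≤ : ∀ z → fst z ≤ z
fst≤ z = subst (fst z ≤_) (pair-fst-snd z) (m≤pair[m,n] (fst z) (snd z))

snd≤ : ∀ z → snd z ≤ z
snd≤ z = subst (snd z ≤_) (pair-fst-snd z) (n≤pair[m,n] (fst z) (snd z))

-- Gödel numbering

byTag : ℕ → Code → Code → Code
byTag 0 _ _ = Z
byTag 1 _ _ = S
byTag 2 _ _ = I
byTag 3 _ _ = L
byTag 4 _ _ = R
byTag 5 a b = comp a b
byTag 6 a b = pr a b
byTag 7 a b = prec a b
byTag (suc (suc (suc (suc (suc (suc (suc (suc _)))))))) a _ = mu a

decodeF-suc : ∀ k e →
  decodeF (suc k) e ≡ byTag (e % 9) (decodeF k (fst (e / 9))) (decodeF k (snd (e / 9)))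
decodeF-suc k e with e % 9
... | 0 = refl
... | 1 = refl
... | 2 = refl
... | 3 = refl
... | 4 = refl
... | 5 = refl
... | 6 = refl
... | 7 = refl
... | suc (suc (suc (suc (suc (suc (suc (suc _))))))) = refl

decodeF-fuel : ∀ {k k′} e → e < k → e < k′ → decodeF k e ≡ decodeF k′ e
decodeF-fuel {suc k} {suc k′} zero      _   _    = refl
decodeF-fuel {suc k} {suc k′} e@(suc _) e<k e<k′ = begin
  decodeF (suc k) e                                       ≡⟨ decodeF-suc k e ⟩
  byTag (e % 9) (decodeF k (fst i)) (decodeF k (snd i))   ≡⟨ cong₂ (byTag (e % 9))
      (decodeF-fuel (fst i) (<-below (fst≤ i) e<k) (<-below (fst≤ i) e<k′))
      (decodeF-fuel (snd i) (<-below (snd≤ i) e<k) (<-below (snd≤ i) e<k′)) ⟩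
  byTag (e % 9) (decodeF k′ (fst i)) (decodeF k′ (snd i)) ≡⟨ decodeF-suc k′ e ⟨
  decodeF (suc k′) e                                      ∎
  where
  open ≡-Reasoning
  i = e / 9
  <-below : ∀ {j x} → x ≤ i → e < suc j → x < j
  <-below x≤i e<1+j = <-≤-trans (≤-<-trans x≤i (m/n<m e 9 (s≤s (s≤s z≤n)))) (s≤s⁻¹ e<1+j)

opaque
  node : ℕ → ℕ → ℕ → ℕ
  node t a b = t + pair a b * 9

opaque
  unfolding node

  node≡ : ∀ t a b → node t a b ≡ t + pair a b * 9
  node≡ t a b = refl

  node%9 : ∀ t a b → t < 9 → node t a b % 9 ≡ t
  node%9 t a b t<9 = trans ([m+kn]%n≡m%n t (pair a b) 9) (m<n⇒m%n≡m t<9)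

  node/9 : ∀ t a b → t < 9 → node t a b / 9 ≡ pair a b
  node/9 t a b t<9 = begin
    (t + pair a b * 9) / 9         ≡⟨ +-distrib-/-∣ʳ t (n∣m*n (pair a b)) ⟩
    t / 9 + pair a b * 9 / 9       ≡⟨ cong₂ _+_ (m<n⇒m/n≡0 t<9) (m*n/n≡m (pair a b) 9) ⟩
    pair a b                       ∎
    where open ≡-Reasoning

  m<node : ∀ t a b .{{_ : NonZero t}} → a < node t a b
  m<node (suc t) a b = s≤s (≤-trans (m≤pair[m,n] a b) (≤-trans (m≤m*n (pair a b) 9) (m≤n+m _ t)))

  n<node : ∀ t a b .{{_ : NonZero t}} → b < node t a b
  n<node (suc t) a b = s≤s (≤-trans (n≤pair[m,n] a b) (≤-trans (m≤m*n (pair a b) 9) (m≤n+m _ t)))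

decode-node : ∀ t {a b} .{{_ : NonZero t}} {t<9 : True (t <? 9)} →
              decode (node t a b) ≡ byTag t (decode a) (decode b)
decode-node t {a} {b} {t<9}
  rewrite decodeF-suc (node t a b) (node t a b)
        | node%9 t a b (toWitness t<9) | node/9 t a b (toWitness t<9)
        | fst-pair a b | snd-pair a b
  = cong₂ (byTag t) (decodeF-fuel a (m<node t a b) ≤-refl) (decodeF-fuel b (n<node t a b) ≤-refl)

⌜_⌝ : Code → ℕ
⌜ Z ⌝        = 0
⌜ S ⌝        = 1
⌜ I ⌝        = 2
⌜ L ⌝        = 3
⌜ R ⌝        = 4
⌜ comp f g ⌝ = node 5 ⌜ f ⌝ ⌜ g ⌝
⌜ pr f g ⌝   = node 6 ⌜ f ⌝ ⌜ g ⌝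
⌜ prec f g ⌝ = node 7 ⌜ f ⌝ ⌜ g ⌝
⌜ mu f ⌝     = node 8 ⌜ f ⌝ 0

decode-quote : ∀ C → decode ⌜ C ⌝ ≡ C
decode-quote Z          = refl
decode-quote S          = refl
decode-quote I          = refl
decode-quote L          = refl
decode-quote R          = refl
decode-quote (comp f g) = trans (decode-node 5) (cong₂ comp (decode-quote f) (decode-quote g))
decode-quote (pr f g)   = trans (decode-node 6) (cong₂ pr (decode-quote f) (decode-quote g))
decode-quote (prec f g) = trans (decode-node 7) (cong₂ prec (decode-quote f) (decode-quote g))
decode-quote (mu f)     = trans (decode-node 8) (cong mu (decode-quote f))

mutual
  Eval-deterministic : ∀ C {x v w} → Eval C x v → Eval C x w → v ≡ w
  Eval-deterministic Z evZ evZ = refl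
  Eval-deterministic S evS evS = refl
  Eval-deterministic I evI evI = refl
  Eval-deterministic L evL evL = refl
  Eval-deterministic R evR evR = refl
  Eval-deterministic (comp f g) (evComp p q) (evComp p′ q′)
    with refl ← Eval-deterministic g p p′ = Eval-deterministic f q q′
  Eval-deterministic (pr f g) (evPr p q) (evPr p′ q′) =
    cong₂ pair (Eval-deterministic f p p′) (Eval-deterministic g q q′)
  Eval-deterministic (prec f g) (evPrec P) (evPrec P′) = PrecEval-deterministic f g P P′
  Eval-deterministic (mu f) (evMu {n = n} z h) (evMu {n = n′} z′ h′) with <-cmp n n′
  ... | tri< n<n′ _ _ = ⊥-elim (0≢1+n (Eval-deterministic f z (proj₂ (h′ n n<n′))))
  ... | tri≈ _ n≡n′ _ = n≡n′
  ... | tri> _ _ n′<n = ⊥-elim (0≢1+n (Eval-deterministic f z′ (proj₂ (h n′ n′<n))))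

  PrecEval-deterministic : ∀ f g {x k v w} → PrecEval f g x k v → PrecEval f g x k w → v ≡ w
  PrecEval-deterministic f g (prZero p) (prZero p′) = Eval-deterministic f p p′
  PrecEval-deterministic f g (prSuc P q) (prSuc P′ q′)
    with refl ← PrecEval-deterministic f g P P′ = Eval-deterministic g q q′

evL-pair : ∀ a b → Eval L (pair a b) a
evL-pair a b = subst (Eval L _) (fst-pair a b) evL

evR-pair : ∀ a b → Eval R (pair a b) b
evR-pair a b = subst (Eval R _) (snd-pair a b) evR

evPrec-pair : ∀ {f g y k v} → PrecEval f g y k v → Eval (prec f g) (pair y k) v
evPrec-pair {f} {g} {y} {k} {v} P =
  evPrec (subst₂ (λ a b → PrecEval f g a b v) (sym (fst-pair y k)) (sym (snd-pair y k)) P)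

evPrec-pair⁻¹ : ∀ {f g y k v} → Eval (prec f g) (pair y k) v → PrecEval f g y k v
evPrec-pair⁻¹ {f} {g} {y} {k} {v} (evPrec P) =
  subst₂ (λ a b → PrecEval f g a b v) (fst-pair y k) (snd-pair y k) P

-- Primitive recursive programs

const : ℕ → Code
const zero    = Z
const (suc n) = comp S (const n)

evConst : ∀ n {x} → Eval (const n) x n
evConst zero    = evZ
evConst (suc n) = evComp (evConst n) evS

add : ℕ → Code
add zero    = I
add (suc t) = comp S (add t)

evAdd : ∀ t {x} → Eval (add t) x (t + x)
evAdd zero    = evI
evAdd (suc t) = evComp (evAdd t) evS

third : Code
third = comp R R

evThird : ∀ a b c → Eval third (pair a (pair b c)) c
evThird a b c = evComp (evR-pair a (pair b c)) (evR-pair b c)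

recursion : Code → Code
recursion g = comp (prec Z g) (pr Z I)

evRecursion : ∀ {g} (r : ℕ → ℕ) → r 0 ≡ 0 →
              (∀ k → Eval g (pair 0 (pair k (r k))) (r (suc k))) →
              ∀ x → Eval (recursion g) x (r x)
evRecursion {g} r r0≡0 step x = evComp (evPr evZ evI) (evPrec-pair (stages x))
  where
  stages : ∀ k → PrecEval Z g 0 k (r k)
  stages zero    = prZero (subst (Eval Z 0) (sym r0≡0) evZ)
  stages (suc k) = prSuc (stages k) (step k)

times9 : Code
times9 = recursion (comp (add 9) third)

evTimes9 : ∀ x → Eval times9 x (x * 9)
evTimes9 = evRecursion (_* 9) refl (λ k → evComp (evThird 0 k (k * 9)) (evAdd 9))

nodeᶜ : ℕ → Code
nodeᶜ t = comp (add t) times9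

evNodeᶜ : ∀ t {a b} → Eval (nodeᶜ t) (pair a b) (node t a b)
evNodeᶜ t {a} {b} = subst (Eval (nodeᶜ t) _) (sym (node≡ t a b)) (evComp (evTimes9 (pair a b)) (evAdd t))

quoteConst : Code
quoteConst = recursion (comp (nodeᶜ 5) (pr (const ⌜ S ⌝) third))

evQuoteConst : ∀ n → Eval quoteConst n ⌜ const n ⌝
evQuoteConst = evRecursion (λ n → ⌜ const n ⌝) refl (λ k → evComp (evPr (evConst 1) (evThird 0 k _)) (evNodeᶜ 5))

predecessor : Code
predecessor = recursion (comp L R)

evPredecessor : ∀ x → Eval predecessor x (pred x)
evPredecessor = evRecursion pred refl (λ k → evComp (evR-pair 0 (pair k (pred k))) (evL-pair k (pred k)))

monus : Code
monus = prec I (comp predecessor third)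

evMonus : ∀ m n → Eval monus (pair m n) (m ∸ n)
evMonus m n = evPrec-pair (stages n)
  where
  stages : ∀ k → PrecEval I (comp predecessor third) m k (m ∸ k)
  stages zero    = prZero evI
  stages (suc k) = prSuc (stages k)
    (subst (Eval _ _) (pred[m∸n]≡m∸[1+n] m k) (evComp (evThird m k (m ∸ k)) (evPredecessor (m ∸ k))))

-- Index expressions

data Expr : Set where
  lit         : ℕ → Expr
  input       : Expr
  fstᴱ sndᴱ   : Expr → Expr
  quoteConstᴱ : Expr → Expr
  nodeᴱ       : ℕ → Expr → Expr → Expr

⟦_⟧ : Expr → ℕ → ℕ
⟦ lit n ⟧         x = n
⟦ input ⟧         x = x
⟦ fstᴱ a ⟧        x = fst (⟦ a ⟧ x)
⟦ sndᴱ a ⟧        x = snd (⟦ a ⟧ x)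
⟦ quoteConstᴱ a ⟧ x = ⌜ const (⟦ a ⟧ x) ⌝
⟦ nodeᴱ t a b ⟧   x = node t (⟦ a ⟧ x) (⟦ b ⟧ x)

compile : Expr → Code
compile (lit n)         = const n
compile input           = I
compile (fstᴱ a)        = comp L (compile a)
compile (sndᴱ a)        = comp R (compile a)
compile (quoteConstᴱ a) = comp quoteConst (compile a)
compile (nodeᴱ t a b)   = comp (nodeᶜ t) (pr (compile a) (compile b))

evCompile : ∀ ex x → Eval (compile ex) x (⟦ ex ⟧ x)
evCompile (lit n)         x = evConst n
evCompile input           x = evI
evCompile (fstᴱ a)        x = evComp (evCompile a x) evL
evCompile (sndᴱ a)        x = evComp (evCompile a x) evR
evCompile (quoteConstᴱ a) x = evComp (evCompile a x) (evQuoteConst _)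
evCompile (nodeᴱ t a b)   x = evComp (evPr (evCompile a x) (evCompile b x)) (evNodeᶜ t)

codeᴱ : Code → Expr
codeᴱ C = lit ⌜ C ⌝

compᴱ prᴱ precᴱ : Expr → Expr → Expr
compᴱ = nodeᴱ 5
prᴱ   = nodeᴱ 6
precᴱ = nodeᴱ 7

-- Column patches

guard : Code → Code → Code
guard C cond = comp (prec Z (comp C L)) (pr I cond)

guard-off : ∀ {C cond x} → Eval cond x 0 → Eval (guard C cond) x 0
guard-off {x = x} c0 = evComp (evPr evI c0) (evPrec-pair {y = x} {k = 0} (prZero evZ))

guard-on : ∀ {C cond x m v} → Eval cond x m → 0 < m → Eval C x v → Eval (guard C cond) x v
guard-on {C} {x = x} {v = v} cm (s≤s {n = k} _) Cv = evComp (evPr evI cm) (evPrec-pair (stages k))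
  where
  step : ∀ j w → Eval (comp C L) (pair x (pair j w)) v
  step j w = evComp (evL-pair x (pair j w)) Cv
  stages : ∀ j → PrecEval Z (comp C L) x (suc j) v
  stages zero    = prSuc (prZero evZ) (step 0 0)
  stages (suc j) = prSuc (stages j) (step (suc j) v)

guard-on⁻¹ : ∀ {C cond x m v} → Eval cond x m → 0 < m → Eval (guard C cond) x v → Eval C x v
guard-on⁻¹ {cond = cond} {x} cm (s≤s {n = k} _) (evComp (evPr evI cm′) Gv)
  with refl ← Eval-deterministic cond cm cm′
  with prSuc _ (evComp Lx Cv) ← evPrec-pair⁻¹ {y = x} {k = suc k} Gv
  with refl ← Eval-deterministic L Lx (evL-pair x _)
  = Cv

columnBelow columnFrom : ℕ → Code
columnBelow n = comp monus (pr (const n) L)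
columnFrom  n = comp monus (pr (comp S L) (const n))

evColumnBelow : ∀ n x → Eval (columnBelow n) x (n ∸ fst x)
evColumnBelow n x = evComp (evPr (evConst n) evL) (evMonus n (fst x))

evColumnFrom : ∀ n x → Eval (columnFrom n) x (suc (fst x) ∸ n)
evColumnFrom n x = evComp (evPr (evComp evL evS) (evConst n)) (evMonus (suc (fst x)) n)

patch : Code → Code → ℕ → Code
patch D E n = pr (guard D (columnBelow n)) (guard E (columnFrom n))

patch-halts : ∀ {D E n x} → (fst x < n → ∃ (Eval D x)) → (n ≤ fst x → ∃ (Eval E x)) →
              ∃ (Eval (patch D E n) x)
patch-halts {n = n} {x} D↓ E↓ with fst x <? n
... | yes x<n = _ , evPr
  (guard-on (evColumnBelow n x) (m<n⇒0<n∸m x<n) (proj₂ (D↓ x<n)))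
  (guard-off (subst (Eval _ x) (m≤n⇒m∸n≡0 x<n) (evColumnFrom n x)))
... | no x≮n = _ , evPr
  (guard-off (subst (Eval _ x) (m≤n⇒m∸n≡0 (≮⇒≥ x≮n)) (evColumnBelow n x)))
  (guard-on (evColumnFrom n x) (m<n⇒0<n∸m (s≤s (≮⇒≥ x≮n))) (proj₂ (E↓ (≮⇒≥ x≮n))))

patch-halts⁻¹ : ∀ {D E n x} → ∃ (Eval (patch D E n) x) →
                (fst x < n → ∃ (Eval D x)) × (n ≤ fst x → ∃ (Eval E x))
patch-halts⁻¹ {n = n} {x} (_ , evPr Dv Ev) =
    (λ x<n → _ , guard-on⁻¹ (evColumnBelow n x) (m<n⇒0<n∸m x<n) Dv)
  , (λ n≤x → _ , guard-on⁻¹ (evColumnFrom n x) (m<n⇒0<n∸m (s≤s n≤x)) Ev)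

guardᴱ : Expr → Expr → Expr
guardᴱ C cond = compᴱ (precᴱ (codeᴱ Z) (compᴱ C (codeᴱ L))) (prᴱ (codeᴱ I) cond)

columnBelowᴱ columnFromᴱ : Expr → Expr
columnBelowᴱ n = compᴱ (codeᴱ monus) (prᴱ (quoteConstᴱ n) (codeᴱ L))
columnFromᴱ  n = compᴱ (codeᴱ monus) (prᴱ (codeᴱ (comp S L)) (quoteConstᴱ n))

patchᴱ : Expr → Expr → Expr → Expr
patchᴱ D E n = prᴱ (guardᴱ D (columnBelowᴱ n)) (guardᴱ E (columnFromᴱ n))

module _ (x : ℕ) where

  decode-guardᴱ : ∀ C cond → decode (⟦ guardᴱ C cond ⟧ x) ≡ guard (decode (⟦ C ⟧ x)) (decode (⟦ cond ⟧ x))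
  decode-guardᴱ C cond = trans (decode-node 5)
    (cong₂ comp (trans (decode-node 7) (cong (prec Z) (decode-node 5))) (decode-node 6))

  decode-columnBelowᴱ : ∀ n → decode (⟦ columnBelowᴱ n ⟧ x) ≡ columnBelow (⟦ n ⟧ x)
  decode-columnBelowᴱ n = trans (decode-node 5) (cong₂ comp (decode-quote monus)
    (trans (decode-node 6) (cong₂ pr (decode-quote (const _)) refl)))

  decode-columnFromᴱ : ∀ n → decode (⟦ columnFromᴱ n ⟧ x) ≡ columnFrom (⟦ n ⟧ x)
  decode-columnFromᴱ n = trans (decode-node 5) (cong₂ comp (decode-quote monus)
    (trans (decode-node 6) (cong₂ pr (decode-quote (comp S L)) (decode-quote (const _)))))

  decode-patchᴱ : ∀ D E n →
    decode (⟦ patchᴱ D E n ⟧ x) ≡ patch (decode (⟦ D ⟧ x)) (decode (⟦ E ⟧ x)) (⟦ n ⟧ x)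
  decode-patchᴱ D E n = trans (decode-node 6) (cong₂ pr
    (trans (decode-guardᴱ D (columnBelowᴱ n)) (cong (guard _) (decode-columnBelowᴱ n)))
    (trans (decode-guardᴱ E (columnFromᴱ n)) (cong (guard _) (decode-columnFromᴱ n))))

-- Evaluated at ⟨e , ⟨n , d⟩⟩.
patchIndexᴱ : Expr
patchIndexᴱ = patchᴱ (sndᴱ (sndᴱ input)) (fstᴱ input) (fstᴱ (sndᴱ input))

patchIndex : ℕ → ℕ → ℕ
patchIndex e k = ⟦ patchIndexᴱ ⟧ (pair e k)

decode-patchIndex : ∀ e k → decode (patchIndex e k) ≡ patch (decode (snd k)) (decode e) (fst k)
decode-patchIndex e k rewrite decode-patchᴱ (pair e k) (sndᴱ (sndᴱ input)) (fstᴱ input) (fstᴱ (sndᴱ input))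
                            | fst-pair e k | snd-pair e k = refl

∈W-patchIndex : ∀ {e k x} → (fst x < fst k → x ∈W snd k) → (fst k ≤ fst x → x ∈W e) →
                x ∈W patchIndex e k
∈W-patchIndex {e} {k} {x} below from =
  subst (λ C → ∃ (Eval C x)) (sym (decode-patchIndex e k)) (patch-halts below from)

∈W-patchIndex⁻¹ : ∀ {e k x} → x ∈W patchIndex e k →
                  (fst x < fst k → x ∈W snd k) × (fst k ≤ fst x → x ∈W e)
∈W-patchIndex⁻¹ {e} {k} {x} x∈ =
  patch-halts⁻¹ (subst (λ C → ∃ (Eval C x)) (decode-patchIndex e k) x∈)

reductionCode : ℕ → Code
reductionCode e = comp (compile patchIndexᴱ) (pr (const e) I)

reduction : ℕ → ℕ
reduction e = ⌜ reductionCode e ⌝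

reduction-computable : TotalComputable reduction
reduction-computable = ⌜ compile reductionᴱ ⌝ , λ e →
  subst (λ C → Eval C e (reduction e)) (sym (decode-quote (compile reductionᴱ))) (evCompile reductionᴱ e)
  where
  reductionᴱ : Expr
  reductionᴱ = compᴱ (codeᴱ (compile patchIndexᴱ)) (prᴱ (quoteConstᴱ input) (codeᴱ I))

evReductionCode : ∀ e k → Eval (reductionCode e) k (patchIndex e k)
evReductionCode e k = evComp (evPr (evConst e) evI) (evCompile patchIndexᴱ (pair e k))

φ-reduction : ∀ e k → φ (reduction e) k (patchIndex e k)
φ-reduction e k =
  subst (λ C → Eval C k (patchIndex e k)) (sym (decode-quote (reductionCode e))) (evReductionCode e k)

φ-reduction⁻¹ : ∀ e k {v} → φ (reduction e) k v → v ≡ patchIndex e k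
φ-reduction⁻¹ e k {v} φv = Eval-deterministic (reductionCode e)
  (subst (λ C → Eval C k v) (decode-quote (reductionCode e)) φv) (evReductionCode e k)

-- Agreement of c.e. sets

⇔-sym : ∀ {A B} → A ⇔ B → B ⇔ A
⇔-sym (f , g) = g , f

⇔-trans : ∀ {A B C} → A ⇔ B → B ⇔ C → A ⇔ C
⇔-trans (f , g) (f′ , g′) = (λ a → f′ (f a)) , (λ c → g (g′ c))

=ce-sym : ∀ {a b} → a =ce b → b =ce a
=ce-sym a=b x = ⇔-sym (a=b x)

=ce-trans : ∀ {a b c} → a =ce b → b =ce c → a =ce c
=ce-trans a=b b=c x = ⇔-trans (a=b x) (b=c x)

AgreeFrom : ℕ → ℕ → ℕ → Set
AgreeFrom N a b = ∀ x → N ≤ fst x → (x ∈W a) ⇔ (x ∈W b)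

AgreeFrom-sym : ∀ {N a b} → AgreeFrom N a b → AgreeFrom N b a
AgreeFrom-sym a≈b x N≤x = ⇔-sym (a≈b x N≤x)

AgreeFrom-trans : ∀ {N a b c} → AgreeFrom N a b → AgreeFrom N b c → AgreeFrom N a c
AgreeFrom-trans a≈b b≈c x N≤x = ⇔-trans (a≈b x N≤x) (b≈c x N≤x)

AgreeFrom-mono : ∀ {M N a b} → M ≤ N → AgreeFrom M a b → AgreeFrom N a b
AgreeFrom-mono M≤N a≈b x N≤x = a≈b x (≤-trans M≤N N≤x)

=ce⇒AgreeFrom : ∀ {N a b} → a =ce b → AgreeFrom N a b
=ce⇒AgreeFrom a=b x _ = a=b x

E₁ce⇒AgreeFrom : ∀ {a b} → E₁ce a b → ∃ λ N → AgreeFrom N a b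
E₁ce⇒AgreeFrom {a} {b} (N , columns) = N , λ x N≤x →
  subst (λ y → (y ∈W a) ⇔ (y ∈W b)) (pair-fst-snd x) (columns (fst x) N≤x (snd x))

AgreeFrom⇒E₁ce : ∀ {N a b} → AgreeFrom N a b → E₁ce a b
AgreeFrom⇒E₁ce {N} a≈b = N , λ n N≤n p →
  a≈b (pair n p) (subst (N ≤_) (sym (fst-pair n p)) N≤n)

patchIndex-agrees : ∀ e k → AgreeFrom (fst k) (patchIndex e k) e
patchIndex-agrees e k x k≤x =
  (λ x∈P → proj₂ (∈W-patchIndex⁻¹ x∈P) k≤x) ,
  (λ x∈e → ∈W-patchIndex (λ x<k → ⊥-elim (<⇒≱ x<k k≤x)) (λ _ → x∈e))

patchIndex-zero : ∀ e → patchIndex e 0 =ce e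
patchIndex-zero e x = patchIndex-agrees e 0 x z≤n

patchIndex-self : ∀ {n c b} → AgreeFrom n c b → patchIndex b (pair n c) =ce c
patchIndex-self {n} {c} {b} c≈b x = to , from
  where
  to : x ∈W patchIndex b (pair n c) → x ∈W c
  to x∈P with fst x <? n | ∈W-patchIndex⁻¹ x∈P
  ... | yes x<n | below , _ = subst (x ∈W_) (snd-pair n c) (below (subst (fst x <_) (sym (fst-pair n c)) x<n))
  ... | no  x≮n | _ , from  = proj₂ (c≈b x (≮⇒≥ x≮n)) (from (subst (_≤ fst x) (sym (fst-pair n c)) (≮⇒≥ x≮n)))
  from : x ∈W c → x ∈W patchIndex b (pair n c)
  from x∈c = ∈W-patchIndex
    (λ _ → subst (x ∈W_) (sym (snd-pair n c)) x∈c)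
    (λ k≤x → proj₁ (c≈b x (subst (_≤ fst x) (fst-pair n c) k≤x)) x∈c)

patchIndex-cover : ∀ {N a b} → AgreeFrom N a b → ∀ k → ∃ λ m → patchIndex a k =ce patchIndex b m
patchIndex-cover {N} {a} {b} a≈b k = pair n (patchIndex a k) , =ce-sym (patchIndex-self P≈b)
  where
  n = fst k ⊔ N
  P≈b : AgreeFrom n (patchIndex a k) b
  P≈b = AgreeFrom-trans (AgreeFrom-mono (m≤m⊔n (fst k) N) (patchIndex-agrees a k))
                        (AgreeFrom-mono (m≤n⊔m (fst k) N) a≈b)

reduction-covers : ∀ {N a b} → AgreeFrom N a b → ∀ k v → φ (reduction a) k v →
                   ∃ λ m → ∃ λ w → φ (reduction b) m w × (v =ce w)
reduction-covers {a = a} {b} a≈b k v φv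
  with refl ← φ-reduction⁻¹ a k φv
  with m , Pk=Pm ← patchIndex-cover a≈b k
  = m , patchIndex b m , φ-reduction b m , Pk=Pm

E₁ce⇒jump : ∀ a b → E₁ce a b → (_=ce_ ⁺) (reduction a) (reduction b)
E₁ce⇒jump a b a~b with N , a≈b ← E₁ce⇒AgreeFrom a~b =
  reduction-covers a≈b , λ m w φw →
    let (k , v , φv , w=v) = reduction-covers (AgreeFrom-sym a≈b) m w φw in k , v , φv , =ce-sym w=v

jump⇒E₁ce : ∀ a b → (_=ce_ ⁺) (reduction a) (reduction b) → E₁ce a b
jump⇒E₁ce a b (covers , _) with covers 0 (patchIndex a 0) (φ-reduction a 0)
... | m , w , φw , Pa0=w with refl ← φ-reduction⁻¹ b m φw =
  AgreeFrom⇒E₁ce (AgreeFrom-trans (=ce⇒AgreeFrom (=ce-trans (=ce-sym (patchIndex-zero a)) Pa0=w))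
                                  (patchIndex-agrees b m))

proposition5p4 : E₁ce ≤c (_=ce_ ⁺)
proposition5p4 = reduction , reduction-computable , λ a b → E₁ce⇒jump a b , jump⇒E₁ce a b
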